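{- Let $p$ be an idempotent in $(\beta\mathbb{N},+)$, let $\langle C_n\rangle_{n=1}^\infty$ be a sequence of members of $p$, and let $\langle a_n\rangle_{n=1}^\infty$ be a sequence in $\mathbb{N}$. Then there exists, for each $n\in\mathbb{N}$, a finite sequence $Y_n$ in $\mathbb{N}$ of length $a_n$ with $\mathrm{FS}(Y_n)\subseteq C_n$, such that for each $F\in\mathcal{P}_f(\mathbb{N})$, $\sum_{n\in F}Y_n\subseteq C_{\min F}$.
   Context: $\beta\mathbb{N}$ is the set of ultrafilters on $\mathbb{N}$ with the extension of $+$: $A\in p+q$ iff $\{x: -x+A\in q\}\in p$, where $-x+A=\{y: x+y\in A\}$; $p$ is idempotent if $p+p=p$. For a finite sequence $\langle x_j\rangle_{j=1}^k$, $\mathrm{FS}(\langle x_j\rangle_{j=1}^k)=\{\sum_{j\in H}x_j: \emptyset\neq H\subseteq\{1,\ldots,k\}\}$. $\mathcal{P}_f(\mathbb{N})$ is the set of nonempty finite subsets of $\mathbb{N}$. For finite nonempty $F$ and sequences $Y_n$, $\sum_{n\in F}Y_n$ is the set of all sums $\sum_{n\in F}y_n$ where each $y_n$ is a term of $Y_n$. -}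

module Defs where

open import Level using (0ℓ)
open import Data.Nat using (ℕ; zero; suc; _+_; _≤_)
open import Data.Bool using (true; false)
open import Data.Vec using (Vec; []; _∷_; lookup)
open import Data.List using (List; []; _∷_)
open import Data.List.Relation.Unary.All using (All; []; _∷_)
open import Data.Fin using (Fin)
open import Data.Fin.Subset using (Subset)
open import Data.Product using (_×_)
open import Data.Sum using (_⊎_)
open import Relation.Nullary using (¬_)
open import Relation.Unary using (Pred; _⊆_; _∩_; ∁; ∅; U)

SetSystem : Set₁
SetSystem = Pred ℕ 0ℓ → Set

record IsUltrafilter (p : SetSystem) : Set₁ where
  field
    whole    : p U
    no-empty : ¬ p ∅
    upward   : ∀ {A B : Pred ℕ 0ℓ} → A ⊆ B → p A → p B
    meet     : ∀ {A B : Pred ℕ 0ℓ} → p A → p B → p (A ∩ B)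
    ultra    : ∀ (A : Pred ℕ 0ℓ) → p A ⊎ p (∁ A)

-- the positive naturals ℕ = {1,2,3,...} of the paper
Positive : Pred ℕ 0ℓ
Positive x = 1 ≤ x

-- -x + A = { y : x + y ∈ A }
shift : ℕ → Pred ℕ 0ℓ → Pred ℕ 0ℓ
shift x A y = A (x + y)

_⊕_ : SetSystem → SetSystem → SetSystem
(p ⊕ q) A = p (λ x → q (shift x A))

IsIdempotent : SetSystem → Set₁
IsIdempotent p = ∀ (A : Pred ℕ 0ℓ) → ((p ⊕ p) A → p A) × (p A → (p ⊕ p) A)

subsetSum : ∀ {k} → Vec ℕ k → Subset k → ℕ
subsetSum []       []           = 0
subsetSum (y ∷ ys) (true  ∷ H)  = y + subsetSum ys H
subsetSum (y ∷ ys) (false ∷ H)  = subsetSum ys H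

-- Σ_{n ∈ F} y_n  where y_n = Y n [ i_n ] is a chosen term of Y n
selSum : (a : ℕ → ℕ) (Y : (n : ℕ) → Vec ℕ (a n)) (F : List ℕ)
       → All (λ n → Fin (a n)) F → ℕ
selSum a Y []       []       = 0
selSum a Y (n ∷ F)  (i ∷ is) = lookup (Y n) i + selSum a Y F is

-- Galvin–Glazer: for A ∈ p put A⋆ = {x ∈ A : -x + A ∈ p}; idempotence gives A⋆ ∈ p and
-- -x + A⋆ ∈ p for every x ∈ A⋆. With B_k = {x ≥ 1} ∩ C_0 ∩ … ∩ C_k, pick
-- x_k ∈ W_k := U_k ∩ B_k⋆ and shrink the reservoir U_{k+1} := U_k ∩ (-x_k + W_k), starting
-- from U_0 = ℕ; all these sets stay in p. Then x_i + x_{j₁} + … + x_{j_r} ∈ W_i ⊆ B_i whenever i < j₁ < … < j_r, by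
-- induction on r. Now let Y_n be the n-th block of a_n consecutive terms of ⟨x_k⟩: block n
-- starts at an index ≥ n, so a sum with one term from each block in F lies in B_j ⊆ C_{min F},
-- j being the index of its term from block min F.
module Submission where

open import Defs
open import Level using (0ℓ)
open import Axiom.ExcludedMiddle using (ExcludedMiddle)
open import Data.Nat using (ℕ; zero; suc; _+_; _≤_; _<_; z≤n; s≤s)
open import Data.Nat.Properties
open import Data.Nat.ListAction using (sum)
open import Data.Nat.ListAction.Properties using (sum-↭)
open import Data.Bool using (true; false)
open import Data.Vec using (Vec; []; _∷_; lookup; there)
open import Data.Vec.Relation.Unary.All using () renaming (All to AllV; [] to []ⱽ; _∷_ to _∷ⱽ_)
open import Data.List using (List; []; _∷_; map)
open import Data.List.Relation.Unary.All as All using (All; []; _∷_)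
open import Data.List.Relation.Unary.AllPairs as AllPairs using (AllPairs; []; _∷_)
open import Data.List.Relation.Unary.Unique.Propositional using (Unique)
open import Data.List.Relation.Unary.Sorted.TotalOrder.Properties using (Sorted⇒AllPairs)
open import Data.List.Relation.Binary.Permutation.Propositional using (↭-sym; ↭⇒↭ₛ)
open import Data.List.Relation.Binary.Permutation.Propositional.Properties using (All-resp-↭; map⁺)
import Data.List.Relation.Binary.Permutation.Setoid.Properties as SetoidPermutation
open import Data.List.Sort ≤-decTotalOrder using (sort; sort-↭; sort-↗)
open import Data.Fin using (Fin; toℕ) renaming (zero to fzero; suc to fsuc)
open import Data.Fin.Properties using (toℕ<n)
open import Data.Fin.Subset using (Subset; Nonempty)
open import Data.Product using (Σ; ∃; _×_; _,_; proj₁; proj₂)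
open import Data.Sum using (inj₁; inj₂)
open import Data.Empty using (⊥-elim)
open import Function using (_∘_)
open import Relation.Nullary using (¬_; yes; no)
open import Relation.Binary.Definitions using (tri<; tri≈; tri>)
open import Relation.Binary.PropositionalEquality
open import Relation.Unary using (Pred; _⊆_; _∩_; U)

sort-strictlyIncreasing : ∀ {ns : List ℕ} → Unique ns → AllPairs _<_ (sort ns)
sort-strictlyIncreasing {ns} ns-unique =
  AllPairs.zipWith (λ (m≤n , m≢n) → ≤∧≢⇒< m≤n m≢n)
    ( Sorted⇒AllPairs ≤-totalOrder (sort-↗ ns)
    , SetoidPermutation.Unique-resp-↭ (setoid ℕ) (↭⇒↭ₛ (↭-sym (sort-↭ ns))) ns-unique)

witness : ExcludedMiddle 0ℓ → ∀ {p : SetSystem} {A : Pred ℕ 0ℓ} → IsUltrafilter p → p A → Σ ℕ A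
witness lem {p} {A} uf pA with lem {Σ ℕ A}
... | yes x∈A = x∈A
... | no  A≡∅ = ⊥-elim (no-empty (upward (λ {x} Ax → A≡∅ (x , Ax)) pA))
  where open IsUltrafilter uf

module IdempotentUltrafilter {p : SetSystem} (uf : IsUltrafilter p) (idem : IsIdempotent p) where
  open IsUltrafilter uf

  ShiftClosed : Pred ℕ 0ℓ → Set
  ShiftClosed A = ∀ x → A x → p (shift x A)

  _⋆ : Pred ℕ 0ℓ → Pred ℕ 0ℓ
  (A ⋆) x = A x × p (shift x A)

  ⋆-∈ : ∀ {A} → p A → p (A ⋆)
  ⋆-∈ {A} pA = meet pA (proj₂ (idem A) pA)

  -- -x + A ∈ p = p + p gives -y + (-x + A) ∈ p for p-many y, i.e. -x + A⋆ ∈ p.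
  ⋆-shiftClosed : ∀ A → ShiftClosed (A ⋆)
  ⋆-shiftClosed A x (_ , p[x+A]) =
    meet p[x+A] (upward (λ {y} → upward (λ {z} → subst A (sym (+-assoc x y z))))
                        (proj₂ (idem (shift x A)) p[x+A]))

  ∩-shiftClosed : ∀ {A B} → ShiftClosed A → ShiftClosed B → ShiftClosed (A ∩ B)
  ∩-shiftClosed A-closed B-closed x (Ax , Bx) = meet (A-closed x Ax) (B-closed x Bx)

  shift-shiftClosed : ∀ {A} c → ShiftClosed A → ShiftClosed (shift c A)
  shift-shiftClosed {A} c A-closed y A[c+y] =
    upward (λ {z} → subst A (+-assoc c y z)) (A-closed (c + y) A[c+y])

module GalvinGlazer (lem : ExcludedMiddle 0ℓ) {p : SetSystem} (uf : IsUltrafilter p)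
  (idem : IsIdempotent p) (B : ℕ → Pred ℕ 0ℓ) (pB : ∀ k → p (B k)) where
  open IsUltrafilter uf
  open IdempotentUltrafilter uf idem

  record Reservoir : Set₁ where
    field
      set          : Pred ℕ 0ℓ
      ∈p           : p set
      shiftClosed  : ShiftClosed set
  open Reservoir

  candidates : ℕ → Reservoir → Pred ℕ 0ℓ
  candidates k R = set R ∩ B k ⋆

  candidates-∈ : ∀ k R → p (candidates k R)
  candidates-∈ k R = meet (∈p R) (⋆-∈ (pB k))

  candidates-shiftClosed : ∀ k R → ShiftClosed (candidates k R)
  candidates-shiftClosed k R = ∩-shiftClosed {set R} (shiftClosed R) (⋆-shiftClosed (B k))

  pick : ∀ k R → Σ ℕ (candidates k R)
  pick k R = witness lem uf (candidates-∈ k R)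

  shrink : ℕ → Reservoir → Reservoir
  shrink k R = record
    { set         = set R ∩ shift c (candidates k R)
    ; ∈p          = meet (∈p R) (candidates-shiftClosed k R c c∈)
    ; shiftClosed = ∩-shiftClosed {set R} (shiftClosed R)
                      (shift-shiftClosed {candidates k R} c (candidates-shiftClosed k R))
    }
    where
    c  = proj₁ (pick k R)
    c∈ = proj₂ (pick k R)

  reservoir : ℕ → Reservoir
  reservoir zero    = record { set = U ; ∈p = whole ; shiftClosed = λ _ _ → whole }
  reservoir (suc k) = shrink k (reservoir k)

  Uₖ Wₖ : ℕ → Pred ℕ 0ℓ
  Uₖ k = set (reservoir k)
  Wₖ k = candidates k (reservoir k)

  x : ℕ → ℕ
  x k = proj₁ (pick k (reservoir k))

  x∈W : ∀ k → Wₖ k (x k)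
  x∈W k = proj₂ (pick k (reservoir k))

  W⊆B : ∀ k → Wₖ k ⊆ B k
  W⊆B k (_ , Bk , _) = Bk

  x∈B : ∀ k → B k (x k)
  x∈B k = W⊆B k (x∈W k)

  U-antitone : ∀ {i j} → i ≤ j → Uₖ j ⊆ Uₖ i
  U-antitone {i} {j} i≤j with m≤n⇒m<n∨m≡n i≤j
  ... | inj₂ refl = λ u → u
  U-antitone {i} {suc j} _ | inj₁ (s≤s i≤j) = λ u → U-antitone i≤j (proj₁ u)

  sum-∈W-increasing : ∀ i t → All (i <_) t → AllPairs _<_ t → Wₖ i (x i + sum (map x t))
  sum-∈W-increasing i []      _         _                    =
    subst (Wₖ i) (sym (+-identityʳ (x i))) (x∈W i)
  -- W_j ⊆ U_j ⊆ U_{i+1} ⊆ -x_i + W_i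
  sum-∈W-increasing i (j ∷ t) (i<j ∷ _) (j<t ∷ t-increasing) =
    proj₂ (U-antitone i<j (proj₁ (sum-∈W-increasing j t j<t t-increasing)))

  sum-∈B-increasing : ∀ i t → All (i <_) t → AllPairs _<_ t → B i (x i + sum (map x t))
  sum-∈B-increasing i t i<t t-increasing = W⊆B i (sum-∈W-increasing i t i<t t-increasing)

  sum-∈B : ∀ i t → All (i <_) t → Unique t → B i (x i + sum (map x t))
  sum-∈B i t i<t t-unique =
    subst (λ s → B i (x i + s)) (sum-↭ (map⁺ x (sort-↭ t)))
      (sum-∈B-increasing i (sort t) (All-resp-↭ (↭-sym (sort-↭ t)) i<t)
         (sort-strictlyIncreasing t-unique))

module Blocks (a : ℕ → ℕ) (x : ℕ → ℕ) where

  block : (k b : ℕ) → Vec ℕ k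
  block zero    b = []
  block (suc k) b = x b ∷ block k (suc b)

  lookup-block : ∀ k b (j : Fin k) → lookup (block k b) j ≡ x (b + toℕ j)
  lookup-block (suc k) b fzero    = cong x (sym (+-identityʳ b))
  lookup-block (suc k) b (fsuc j) =
    trans (lookup-block k (suc b) j) (cong x (sym (+-suc b (toℕ j))))

  block-All : ∀ {P : Pred ℕ 0ℓ} → (∀ i → P (x i)) → ∀ k b → AllV P (block k b)
  block-All Px zero    b = []ⱽ
  block-All Px (suc k) b = Px b ∷ⱽ block-All Px k (suc b)

  selected : ∀ k → ℕ → Subset k → List ℕ
  selected zero    b []          = []
  selected (suc k) b (true  ∷ H) = b ∷ selected k (suc b) H
  selected (suc k) b (false ∷ H) = selected k (suc b) H

  selected-≥ : ∀ k b H → All (b ≤_) (selected k b H)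
  selected-≥ zero    b []          = []
  selected-≥ (suc k) b (true  ∷ H) =
    ≤-refl ∷ All.map (≤-trans (n≤1+n b)) (selected-≥ k (suc b) H)
  selected-≥ (suc k) b (false ∷ H) = All.map (≤-trans (n≤1+n b)) (selected-≥ k (suc b) H)

  selected-increasing : ∀ k b H → AllPairs _<_ (selected k b H)
  selected-increasing zero    b []          = []
  selected-increasing (suc k) b (true  ∷ H) =
    selected-≥ k (suc b) H ∷ selected-increasing k (suc b) H
  selected-increasing (suc k) b (false ∷ H) = selected-increasing k (suc b) H

  subsetSum-block : ∀ k b H → subsetSum (block k b) H ≡ sum (map x (selected k b H))
  subsetSum-block zero    b []          = refl
  subsetSum-block (suc k) b (true  ∷ H) = cong (x b +_) (subsetSum-block k (suc b) H)
  subsetSum-block (suc k) b (false ∷ H) = subsetSum-block k (suc b) H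

  offset : ℕ → ℕ
  offset zero    = 0
  offset (suc n) = offset n + a n

  offset-monotone : ∀ {m n} → m ≤ n → offset m ≤ offset n
  offset-monotone {m} {n} m≤n with m≤n⇒m<n∨m≡n m≤n
  ... | inj₂ refl = ≤-refl
  offset-monotone {m} {suc n} _ | inj₁ (s≤s m≤n) =
    ≤-trans (offset-monotone m≤n) (m≤m+n (offset n) (a n))

  n≤offset : (∀ n → 1 ≤ a n) → ∀ n → n ≤ offset n
  n≤offset a≥1 zero    = z≤n
  n≤offset a≥1 (suc n) =
    subst (_≤ offset n + a n) (+-comm n 1) (+-mono-≤ (n≤offset a≥1 n) (a≥1 n))

  Y : (n : ℕ) → Vec ℕ (a n)
  Y n = block (a n) (offset n)

  position : (n : ℕ) → Fin (a n) → ℕ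
  position n i = offset n + toℕ i

  position-< : ∀ {m n} (i : Fin (a m)) (j : Fin (a n)) → m < n → position m i < position n j
  position-< {m} {n} i j m<n =
    ≤-trans (+-monoʳ-< (offset m) (toℕ<n i))
            (≤-trans (offset-monotone m<n) (m≤m+n (offset n) (toℕ j)))

  position-≢ : ∀ {m n} (i : Fin (a m)) (j : Fin (a n)) → ¬ m ≡ n → ¬ position m i ≡ position n j
  position-≢ {m} {n} i j m≢n eq with <-cmp m n
  ... | tri< m<n _ _ = <-irrefl eq (position-< i j m<n)
  ... | tri≈ _ m≡n _ = m≢n m≡n
  ... | tri> _ _ n<m = <-irrefl (sym eq) (position-< j i n<m)

  positions : (ns : List ℕ) → All (λ n → Fin (a n)) ns → List ℕ
  positions []       []       = []
  positions (n ∷ ns) (i ∷ is) = position n i ∷ positions ns is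

  positions-All : ∀ {P Q : Pred ℕ 0ℓ} → (∀ {n} (i : Fin (a n)) → P n → Q (position n i))
                → ∀ ns is → All P ns → All Q (positions ns is)
  positions-All f []       []       []         = []
  positions-All f (n ∷ ns) (i ∷ is) (Pn ∷ Pns) = f i Pn ∷ positions-All f ns is Pns

  positions-unique : ∀ ns is → Unique ns → Unique (positions ns is)
  positions-unique []       []       []              = []
  positions-unique (n ∷ ns) (i ∷ is) (n∉ns ∷ ns-unique) =
    positions-All (position-≢ i) ns is n∉ns ∷ positions-unique ns is ns-unique

  selSum-positions : ∀ ns is → selSum a Y ns is ≡ sum (map x (positions ns is))
  selSum-positions []       []       = refl
  selSum-positions (n ∷ ns) (i ∷ is) =
    cong₂ _+_ (lookup-block (a n) (offset n) i) (selSum-positions ns is)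

module Construction (lem : ExcludedMiddle 0ℓ) {p : SetSystem} (uf : IsUltrafilter p)
  (p-positive : p Positive) (idem : IsIdempotent p)
  (C : ℕ → Pred ℕ 0ℓ) (pC : ∀ n → p (C n))
  (a : ℕ → ℕ) (a≥1 : ∀ n → 1 ≤ a n) where
  open IsUltrafilter uf

  ⋂C : ℕ → Pred ℕ 0ℓ
  ⋂C zero    = Positive ∩ C 0
  ⋂C (suc k) = ⋂C k ∩ C (suc k)

  ⋂C-∈ : ∀ k → p (⋂C k)
  ⋂C-∈ zero    = meet p-positive (pC 0)
  ⋂C-∈ (suc k) = meet (⋂C-∈ k) (pC (suc k))

  ⋂C⊆Positive : ∀ k → ⋂C k ⊆ Positive
  ⋂C⊆Positive zero    = proj₁
  ⋂C⊆Positive (suc k) = ⋂C⊆Positive k ∘ proj₁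

  ⋂C⊆C : ∀ {n k} → n ≤ k → ⋂C k ⊆ C n
  ⋂C⊆C {n} {k} n≤k with m≤n⇒m<n∨m≡n n≤k
  ⋂C⊆C {zero}  {zero}  _ | inj₂ refl = proj₂
  ⋂C⊆C {suc n} {suc n} _ | inj₂ refl = proj₂
  ⋂C⊆C {n}     {suc k} _ | inj₁ (s≤s n≤k) = ⋂C⊆C n≤k ∘ proj₁

  open GalvinGlazer lem uf idem ⋂C ⋂C-∈ using (x; x∈B; sum-∈B-increasing; sum-∈B)
  open Blocks a x public

  Y-positive : ∀ n → AllV Positive (Y n)
  Y-positive n = block-All (λ i → ⋂C⊆Positive i (x∈B i)) (a n) (offset n)

  subsetSum-block-∈ : ∀ k b (H : Subset k) → Nonempty H
                    → ∃ λ j → b ≤ j × ⋂C j (subsetSum (block k b) H)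
  subsetSum-block-∈ (suc k) b (true ∷ H) _ =
    b , ≤-refl , subst (⋂C b) (cong (x b +_) (sym (subsetSum-block k (suc b) H)))
                   (sum-∈B-increasing b (selected k (suc b) H)
                      (selected-≥ k (suc b) H) (selected-increasing k (suc b) H))
  subsetSum-block-∈ (suc k) b (false ∷ H) (fsuc j , there j∈H) =
    let (i , b<i , i∈⋂C) = subsetSum-block-∈ k (suc b) H (j , j∈H)
    in  i , ≤-trans (n≤1+n b) b<i , i∈⋂C

  Y-FS : ∀ n (H : Subset (a n)) → Nonempty H → C n (subsetSum (Y n) H)
  Y-FS n H H≢∅ =
    let (j , offset≤j , ∈⋂C) = subsetSum-block-∈ (a n) (offset n) H H≢∅
    in ⋂C⊆C (≤-trans (n≤offset a≥1 n) offset≤j) ∈⋂C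

  Y-sums : ∀ m ns → Unique (m ∷ ns) → All (m ≤_) ns
         → (is : All (λ k → Fin (a k)) (m ∷ ns)) → C m (selSum a Y (m ∷ ns) is)
  Y-sums m ns (m∉ns ∷ ns-unique) m≤ns (i ∷ is) =
    ⋂C⊆C (≤-trans (n≤offset a≥1 m) (m≤m+n (offset m) (toℕ i)))
      (subst (⋂C (position m i)) (sym (selSum-positions (m ∷ ns) (i ∷ is)))
        (sum-∈B (position m i) (positions ns is)
          (positions-All (position-< i) ns is
             (All.zipWith (λ (m≤n , m≢n) → ≤∧≢⇒< m≤n m≢n) (m≤ns , m∉ns)))
          (positions-unique ns is ns-unique)))

theorem2p4 : ExcludedMiddle 0ℓ
    → (p : SetSystem) → IsUltrafilter p → p Positive → IsIdempotent p
    → (C : ℕ → Pred ℕ 0ℓ) → (∀ n → p (C n))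
    → (a : ℕ → ℕ) → (∀ n → 1 ≤ a n)
    → Σ ((n : ℕ) → Vec ℕ (a n)) λ Y
        → (∀ n → AllV Positive (Y n))
        × (∀ n → (H : Subset (a n)) → Nonempty H → C n (subsetSum (Y n) H))
        × (∀ (m : ℕ) (ns : List ℕ) → Unique (m ∷ ns) → All (m ≤_) ns
             → (is : All (λ k → Fin (a k)) (m ∷ ns)) → C m (selSum a Y (m ∷ ns) is))
theorem2p4 lem p uf p-positive idem C pC a a≥1 = Y , Y-positive , Y-FS , Y-sums
  where open Construction lem uf p-positive idem C pC a a≥1
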